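{- Let $\mu\in\{0,1\}^N$ and $\lambda\subseteq\{1,\ldots,N\}$ be such that $(\lambda\cap S_\mu,\lambda\cap T_\mu)$ satisfies: $|\lambda\cap S_\mu|=|\lambda\cap T_\mu|=:n$ and for each $1\le i\le n$ the $i$-th smallest element of $\lambda\cap S_\mu$ is strictly smaller than the $i$-th smallest element of $\lambda\cap T_\mu$. Then for every $q\in\mathbb{C}$ with $q\ne0,1$, \[ \sum_\sigma q^{\mathrm{inv}(\sigma)}=\prod_{s\in\lambda\cap S_\mu}\frac{q^{\rho(s,\mu,\lambda)}-1}{q-1}, \] where the sum runs over all rook placements $\sigma$ on $B_\mu$ of type $\lambda$.
   Context: $N\ge1$. For $\mu\in\{0,1\}^N$: $S_\mu=\{s:\mu_s=0\}$, $T_\mu=\{t:\mu_t=1\}$ (subsets of $\{1,\ldots,N\}$), $B_\mu=\{(s,t)\in S_\mu\times T_\mu:s<t\}$, $S_\mu(m)=\{s\in S_\mu:s\le m\}$, $T_\mu(m)=\{t\in T_\mu:t\ge m\}$. A rook placement on $B_\mu$ is a subset $\sigma\subseteq B_\mu$ no two of whose elements share a first or a second coordinate; its type is $\pi_1(\sigma)\cup\pi_2(\sigma)$, where $\pi_1(\sigma)$ (resp. $\pi_2(\sigma)$) is the set of first (resp. second) coordinates of elements of $\sigma$. The inversion number is $\mathrm{inv}(\sigma)=\sum_{(s,t)\in\sigma}|\{(s',t')\in\sigma: s'<s,\ t'>t\}|$. Finally $\rho(m,\mu,\lambda)=|\lambda\cap S_\mu(m)|+|\lambda\cap T_\mu(m)|-|\lambda|/2$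 (this equals $|\sigma\cap(S_\mu(m)\times T_\mu(m))|$ for any rook placement $\sigma$ on $B_\mu$ of type $\lambda$). -}

module Defs where

open import Level using (Level)
open import Data.Bool using (Bool; true; false; not; _∧_; _∨_; if_then_else_)
open import Data.Nat using (ℕ; zero; suc; _+_; _∸_; _<ᵇ_; _≡ᵇ_; _/_)
open import Data.Fin using (Fin; toℕ)
open import Data.List using (List; []; _∷_; filter; map; length; concatMap; allFin; foldr)
open import Data.Product using (_×_; _,_; proj₁; proj₂)
open import Relation.Nullary.Decidable using (does)
open import Relation.Binary.PropositionalEquality using (_≡_)
open import Relation.Unary using (Decidable)
open import Algebra.Bundles using (CommutativeRing)

-- Positions {1,…,N} are represented by Fin N (0-indexed, order preserved).
-- μ ∈ {0,1}^N is a function Fin N → Bool (false = 0, true = 1).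

Word : ℕ → Set
Word N = Fin N → Bool

SubsetN : ℕ → Set
SubsetN N = Fin N → Bool

_<F_ : ∀ {N} → Fin N → Fin N → Bool
a <F b = toℕ a <ᵇ toℕ b

_≟F_ : ∀ {N} → Fin N → Fin N → Bool
a ≟F b = toℕ a ≡ᵇ toℕ b

inS : ∀ {N} → Word N → Fin N → Bool
inS μ s = not (μ s)

inT : ∀ {N} → Word N → Fin N → Bool
inT μ t = μ t

boolFilter : ∀ {A : Set} → (A → Bool) → List A → List A
boolFilter p [] = []
boolFilter p (x ∷ xs) = if p x then x ∷ boolFilter p xs else boolFilter p xs

allB : ∀ {A : Set} → (A → Bool) → List A → Bool
allB p [] = true
allB p (x ∷ xs) = p x ∧ allB p xs

anyB : ∀ {A : Set} → (A → Bool) → List A → Bool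
anyB p [] = false
anyB p (x ∷ xs) = p x ∨ anyB p xs

count : ∀ {A : Set} → (A → Bool) → List A → ℕ
count p xs = length (boolFilter p xs)

elems : ∀ {N} → SubsetN N → List (Fin N)
elems {N} X = boolFilter X (allFin N)

card : ∀ {N} → SubsetN N → ℕ
card X = length (elems X)

lamS : ∀ {N} → Word N → SubsetN N → List (Fin N)
lamS μ lam = boolFilter (λ x → lam x ∧ inS μ x) (allFin _)

lamT : ∀ {N} → Word N → SubsetN N → List (Fin N)
lamT μ lam = boolFilter (λ x → lam x ∧ inT μ x) (allFin _)

Cell : ℕ → Set
Cell N = Fin N × Fin N

inB : ∀ {N} → Word N → Cell N → Bool
inB μ (s , t) = inS μ s ∧ inT μ t ∧ (s <F t)

allCells : (N : ℕ) → List (Cell N)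
allCells N = concatMap (λ s → map (λ t → (s , t)) (allFin N)) (allFin N)

board : ∀ {N} → Word N → List (Cell N)
board {N} μ = boolFilter (inB μ) (allCells N)

-- all sublists of a list; for a repetition-free list these are exactly
-- its subsets (each subset listed exactly once)
sublists : ∀ {A : Set} → List A → List (List A)
sublists [] = [] ∷ []
sublists (x ∷ xs) = let r = sublists xs in r Data.List.++ map (x ∷_) r

isRook : ∀ {N} → List (Cell N) → Bool
isRook [] = true
isRook ((s , t) ∷ σ) =
  allB (λ c → not (proj₁ c ≟F s) ∧ not (proj₂ c ≟F t)) σ ∧ isRook σ

typeOf : ∀ {N} → List (Cell N) → SubsetN N
typeOf σ x = anyB (λ c → (proj₁ c ≟F x) ∨ (proj₂ c ≟F x)) σ

sameSubset : ∀ {N} → SubsetN N → SubsetN N → Bool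
sameSubset {N} X Y = allB (λ x → X x ≡ᵇB Y x) (allFin N)
  where
  _≡ᵇB_ : Bool → Bool → Bool
  true ≡ᵇB b = b
  false ≡ᵇB b = not b

rookPlacements : ∀ {N} → Word N → SubsetN N → List (List (Cell N))
rookPlacements μ lam =
  boolFilter (λ σ → isRook σ ∧ sameSubset (typeOf σ) lam) (sublists (board μ))

inv : ∀ {N} → List (Cell N) → ℕ
inv σ = foldr (λ c acc → count (λ c' → (proj₁ c' <F proj₁ c) ∧ (proj₂ c <F proj₂ c')) σ + acc) 0 σ

-- ρ(m,μ,λ) = |λ ∩ S_μ(m)| + |λ ∩ T_μ(m)| − |λ|/2
-- (natural-number version; |λ|/2 is floor division, ∸ is truncated
--  subtraction; under the hypotheses of Lemma 3.10 both are exact)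
rho : ∀ {N} → Fin N → Word N → SubsetN N → ℕ
rho m μ lam =
  (count (λ x → lam x ∧ inS μ x ∧ ((x <F m) ∨ (x ≟F m))) (allFin _)
   + count (λ x → lam x ∧ inT μ x ∧ ((m <F x) ∨ (x ≟F m))) (allFin _))
  ∸ (card lam / 2)

data AllPairs {N : ℕ} : List (Fin N) → List (Fin N) → Set where
  []  : AllPairs [] []
  _∷_ : ∀ {a b as bs} → toℕ a Data.Nat.< toℕ b → AllPairs as bs → AllPairs (a ∷ as) (b ∷ bs)

Admissible : ∀ {N} → Word N → SubsetN N → Set
Admissible μ lam = length (lamS μ lam) ≡ length (lamT μ lam) × AllPairs (lamS μ lam) (lamT μ lam)

module RingOps {c ℓ : Level} (R : CommutativeRing c ℓ) where
  open CommutativeRing R using (Carrier) renaming (_+_ to _+R_; _*_ to _*R_; 0# to 0R; 1# to 1R)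

  pow : Carrier → ℕ → Carrier
  pow x zero = 1R
  pow x (suc n) = x *R pow x n

  sumR : List Carrier → Carrier
  sumR = foldr _+R_ 0R

  prodR : List Carrier → Carrier
  prodR = foldr _*R_ 1R

module Submission where

-- Group the cells of B_μ by rows (the first coordinate s ∈ S_μ) and induct over the rows from
-- left to right. A rook placement meets the last row y in at most one cell. If y ∉ λ that row
-- must stay empty. If y ∈ λ, a placement of type λ has a rook on some (y, t) with t ∈ λ ∩ T_μ,
-- t > y, and deleting it leaves a placement of type λ ∖ {y, t} on the earlier rows. The deleted
-- rook lies in the last row, so it forms inversions exactly with the earlier rooks in columns
-- above t, i.e. with #{z ∈ λ ∩ T_μ : z > t} of them. Summing q to that power over t gives
-- 1 + q + ⋯ + q^(k−1) with k = #{z ∈ λ ∩ T_μ : z > y} = ρ(y, μ, λ), while ρ(s, μ, λ) does not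
-- change for s < y.

open import Defs
open import Level using (Level)
open import Algebra.Bundles using (CommutativeRing; CommutativeMonoid)
open import Data.Bool using (Bool; true; false; not; _∧_; _∨_; if_then_else_)
open import Data.Bool.Properties
  using (∧-zeroʳ; ∧-identityʳ; ∧-assoc; ∨-zeroʳ; ∨-identityʳ; ∧-conicalˡ; ∧-conicalʳ; ∨-assoc; T-≡; not-injective; ∧-commutativeMonoid)
open import Algebra.Properties.CommutativeSemigroup (CommutativeMonoid.commutativeSemigroup ∧-commutativeMonoid)
  using () renaming (interchange to ∧-interchange)
open import Data.Empty using (⊥-elim)
open import Data.Fin using (Fin; toℕ; _<_) renaming (zero to fzero; suc to fsuc)
open import Data.Fin.Properties using (toℕ-injective; _≟_; suc-injective; <⇒≢)
open import Data.List using (List; []; _∷_; _++_; _∷ʳ_; map; length; foldr; concatMap; allFin; tabulate)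
open import Data.List.Properties using (length-++; map-tabulate; map-∘; ++-identityʳ; concatMap-++)
open import Data.List.Membership.Propositional using (_∈_)
open import Data.List.Membership.Propositional.Properties using (∈-allFin; ∈-++⁻)
open import Data.List.Relation.Unary.All as All using (All; []; _∷_)
import Data.List.Relation.Unary.All.Properties as Allₚ
import Data.List.Relation.Unary.AllPairs as AllPairs
open import Data.List.Reverse using (Reverse; []; _∶_∶ʳ_; reverseView)
open import Data.List.Relation.Unary.AllPairs.Properties using (tabulate⁺-<)
open import Data.List.Relation.Unary.Any using (here)
open import Data.Nat as ℕ using (ℕ; zero; suc; _∸_; _/_)
open import Data.Nat.DivMod using (m*n/n≡m)
import Data.Nat.Properties as ℕ
open import Data.Product using (Σ; _×_; _,_; proj₁; proj₂)
open import Data.Sum using (_⊎_; inj₁; inj₂)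
open import Data.Unit using (tt)
open import Function using (_∘_; id; Equivalence)
open import Relation.Binary.PropositionalEquality
  using (_≡_; _≢_; refl; sym; trans; cong; cong₂; subst; _≗_; ≢-sym; module ≡-Reasoning)
open import Relation.Nullary using (¬_; yes; no)

private variable
  A B : Set

∧-true⁻ : ∀ {a b} → a ∧ b ≡ true → a ≡ true × b ≡ true
∧-true⁻ e = ∧-conicalˡ _ _ e , ∧-conicalʳ _ _ e

true≢false : true ≢ false
true≢false ()

∧-false-trueʳ : ∀ {a b} → a ∧ b ≡ false → b ≡ true → a ≡ false
∧-false-trueʳ {a} e refl = trans (sym (∧-identityʳ a)) e

bool-ext : ∀ {a b} → (a ≡ true → b ≡ true) → (b ≡ true → a ≡ true) → a ≡ b
bool-ext {false} {false} _ _ = refl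
bool-ext {false} {true}  _ g = g refl
bool-ext {true}  {false} f _ = sym (f refl)
bool-ext {true}  {true}  _ _ = refl

module _ {N : ℕ} where

  ≟F-refl : (x : Fin N) → (x ≟F x) ≡ true
  ≟F-refl x = Equivalence.to T-≡ (ℕ.≡⇒≡ᵇ (toℕ x) (toℕ x) refl)

  ≟F⇒≡ : {x y : Fin N} → (x ≟F y) ≡ true → x ≡ y
  ≟F⇒≡ {x} {y} e = toℕ-injective (ℕ.≡ᵇ⇒≡ (toℕ x) (toℕ y) (Equivalence.from T-≡ e))

  ≢⇒≟F-false : {x y : Fin N} → x ≢ y → (x ≟F y) ≡ false
  ≢⇒≟F-false {x} {y} x≢y with x ≟F y in e
  ... | true  = ⊥-elim (x≢y (≟F⇒≡ e))
  ... | false = refl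

  ≟F-false⇒≢ : {x y : Fin N} → (x ≟F y) ≡ false → x ≢ y
  ≟F-false⇒≢ {x} e refl with trans (sym e) (≟F-refl x)
  ... | ()

  <F⇒< : {x y : Fin N} → (x <F y) ≡ true → x < y
  <F⇒< {x} {y} e = ℕ.<ᵇ⇒< (toℕ x) (toℕ y) (Equivalence.from T-≡ e)

  <⇒<F : {x y : Fin N} → x < y → (x <F y) ≡ true
  <⇒<F x<y = Equivalence.to T-≡ (ℕ.<⇒<ᵇ x<y)

  ≮⇒<F-false : {x y : Fin N} → ¬ x < y → (x <F y) ≡ false
  ≮⇒<F-false {x} {y} x≮y with x <F y in e
  ... | true  = ⊥-elim (x≮y (<F⇒< e))
  ... | false = refl

  >⇒<F-false : {x y : Fin N} → y < x → (x <F y) ≡ false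
  >⇒<F-false y<x = ≮⇒<F-false (ℕ.<-asym y<x)

  ≟F-sym : (x y : Fin N) → (x ≟F y) ≡ (y ≟F x)
  ≟F-sym x y = bool-ext (flip x y) (flip y x)
    where
    flip : ∀ a b → (a ≟F b) ≡ true → (b ≟F a) ≡ true
    flip a b e = subst (λ z → (z ≟F a) ≡ true) (≟F⇒≡ {x = a} {y = b} e) (≟F-refl a)

  <F-irrefl : (x : Fin N) → (x <F x) ≡ false
  <F-irrefl x = ≮⇒<F-false {x} {x} (ℕ.<-irrefl refl)

  ≤⇒≤F : {x y : Fin N} → toℕ x ℕ.≤ toℕ y → ((x <F y) ∨ (x ≟F y)) ≡ true
  ≤⇒≤F {x} {y} x≤y with ℕ.m≤n⇒m<n∨m≡n x≤y
  ... | inj₁ x<y rewrite <⇒<F x<y = refl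
  ... | inj₂ x≡y rewrite toℕ-injective x≡y | ≟F-refl y = ∨-zeroʳ _


boolFilter-++ : (p : A → Bool) (xs ys : List A) → boolFilter p (xs ++ ys) ≡ boolFilter p xs ++ boolFilter p ys
boolFilter-++ p []       ys = refl
boolFilter-++ p (x ∷ xs) ys with p x
... | true  = cong (x ∷_) (boolFilter-++ p xs ys)
... | false = boolFilter-++ p xs ys

boolFilter-map : (p : B → Bool) (f : A → B) (xs : List A) → boolFilter p (map f xs) ≡ map f (boolFilter (p ∘ f) xs)
boolFilter-map p f []       = refl
boolFilter-map p f (x ∷ xs) with p (f x)
... | true  = cong (f x ∷_) (boolFilter-map p f xs)
... | false = boolFilter-map p f xs

boolFilter-concatMap : (p : B → Bool) (f : A → List B) (xs : List A) →
  boolFilter p (concatMap f xs) ≡ concatMap (boolFilter p ∘ f) xs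
boolFilter-concatMap p f []       = refl
boolFilter-concatMap p f (x ∷ xs) =
  trans (boolFilter-++ p (f x) (concatMap f xs)) (cong (boolFilter p (f x) ++_) (boolFilter-concatMap p f xs))

boolFilter-congᴬ : {p p′ : A → Bool} {xs : List A} → All (λ x → p x ≡ p′ x) xs → boolFilter p xs ≡ boolFilter p′ xs
boolFilter-congᴬ {p = p} {p′} {x ∷ xs} (e ∷ es) with p x | p′ x | e
... | true  | .true  | refl = cong (x ∷_) (boolFilter-congᴬ es)
... | false | .false | refl = boolFilter-congᴬ es
boolFilter-congᴬ [] = refl

boolFilter-cong : {p p′ : A → Bool} → p ≗ p′ → (xs : List A) → boolFilter p xs ≡ boolFilter p′ xs
boolFilter-cong e xs = boolFilter-congᴬ (All.universal e xs)

boolFilter-All : {P : A → Set} (p : A → Bool) {xs : List A} → All P xs → All (λ x → P x × p x ≡ true) (boolFilter p xs)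
boolFilter-All p {x ∷ xs} (px ∷ pxs) with p x in e
... | true  = (px , e) ∷ boolFilter-All p pxs
... | false = boolFilter-All p pxs
boolFilter-All p [] = []

count-++ : (p : A → Bool) (xs ys : List A) → count p (xs ++ ys) ≡ count p xs ℕ.+ count p ys
count-++ p xs ys = trans (cong length (boolFilter-++ p xs ys)) (length-++ (boolFilter p xs))

count-congᴬ : {p p′ : A → Bool} {xs : List A} → All (λ x → p x ≡ p′ x) xs → count p xs ≡ count p′ xs
count-congᴬ es = cong length (boolFilter-congᴬ es)

count-cong : {p p′ : A → Bool} → p ≗ p′ → (xs : List A) → count p xs ≡ count p′ xs
count-cong e xs = cong length (boolFilter-cong e xs)

allB-++ : (p : A → Bool) (xs ys : List A) → allB p (xs ++ ys) ≡ allB p xs ∧ allB p ys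
allB-++ p []       ys = refl
allB-++ p (x ∷ xs) ys = trans (cong (p x ∧_) (allB-++ p xs ys)) (sym (∧-assoc (p x) _ _))

anyB-++ : (p : A → Bool) (xs ys : List A) → anyB p (xs ++ ys) ≡ anyB p xs ∨ anyB p ys
anyB-++ p []       ys = refl
anyB-++ p (x ∷ xs) ys = trans (cong (p x ∨_) (anyB-++ p xs ys)) (sym (∨-assoc (p x) _ _))

allB-true⁻ : (p : A → Bool) (xs : List A) → allB p xs ≡ true → All (λ x → p x ≡ true) xs
allB-true⁻ p []       _ = []
allB-true⁻ p (x ∷ xs) e = proj₁ (∧-true⁻ e) ∷ allB-true⁻ p xs (proj₂ (∧-true⁻ e))

allB-congᴬ : {p p′ : A → Bool} {xs : List A} → All (λ x → p x ≡ p′ x) xs → allB p xs ≡ allB p′ xs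
allB-congᴬ []       = refl
allB-congᴬ (e ∷ es) = cong₂ _∧_ e (allB-congᴬ es)

allB-false⁻ : (p : A → Bool) (xs : List A) → allB p xs ≡ false → Σ A (λ x → p x ≡ false)
allB-false⁻ p (x ∷ xs) e with p x in px
... | true  = allB-false⁻ p xs e
... | false = x , px

allB-not : (p : A → Bool) (xs : List A) → allB (not ∘ p) xs ≡ not (anyB p xs)
allB-not p []       = refl
allB-not p (x ∷ xs) with p x
... | true  = refl
... | false = allB-not p xs

anyB-false⁺ : (p : A → Bool) {xs : List A} → All (λ x → p x ≡ false) xs → anyB p xs ≡ false
anyB-false⁺ p []       = refl
anyB-false⁺ p (e ∷ es) rewrite e = anyB-false⁺ p es


∈-∷ʳ⁻ : {x y : A} (xs : List A) → x ∈ xs ∷ʳ y → x ∈ xs ⊎ x ≡ y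
∈-∷ʳ⁻ xs x∈ with ∈-++⁻ xs x∈
... | inj₁ x∈xs        = inj₁ x∈xs
... | inj₂ (here x≡y) = inj₂ x≡y

AllPairs-∷ʳ⁻ : {R : A → A → Set} {y : A} (xs : List A) → AllPairs.AllPairs R (xs ∷ʳ y) →
  AllPairs.AllPairs R xs × All (λ x → R x y) xs
AllPairs-∷ʳ⁻ []       _          = AllPairs.[] , []
AllPairs-∷ʳ⁻ (x ∷ xs) (rx AllPairs.∷ rxs) with Allₚ.++⁻ xs rx | AllPairs-∷ʳ⁻ xs rxs
... | rx′ , (rxy ∷ []) | rxs′ , below = (rx′ AllPairs.∷ rxs′) , (rxy ∷ below)

boolFilter-none : (xs : List A) → boolFilter (λ _ → false) xs ≡ []
boolFilter-none []       = refl
boolFilter-none (x ∷ xs) = boolFilter-none xs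

count-split : (p h : A → Bool) (xs : List A) →
  count p xs ≡ count (λ x → p x ∧ not (h x)) xs ℕ.+ count (λ x → p x ∧ h x) xs
count-split p h []       = refl
count-split p h (x ∷ xs) with p x | h x
... | true  | true  = trans (cong suc (count-split p h xs)) (sym (ℕ.+-suc _ _))
... | true  | false = cong suc (count-split p h xs)
... | false | _     = count-split p h xs

count-cons : (p : A → Bool) (x : A) (xs : List A) → count p (x ∷ xs) ≡ (if p x then suc (count p xs) else count p xs)
count-cons p x xs with p x
... | true  = refl
... | false = refl

module _ {N : ℕ} where

  sameSubset-true⁻ : (X Y : SubsetN N) → sameSubset X Y ≡ true → X ≗ Y
  sameSubset-true⁻ X Y e x with X x | Y x | All.lookup (allB-true⁻ _ (allFin N) e) (∈-allFin x)
  ... | true  | true  | _ = refl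
  ... | false | false | _ = refl

  sameSubset-true⁺ : (X Y : SubsetN N) → X ≗ Y → sameSubset X Y ≡ true
  sameSubset-true⁺ X Y X≗Y with sameSubset X Y in e
  ... | true  = refl
  ... | false with allB-false⁻ _ (allFin N) e
  ... | x , px with X x | Y x | X≗Y x
  sameSubset-true⁺ X Y X≗Y | false | x , () | true  | .true  | refl
  sameSubset-true⁺ X Y X≗Y | false | x , () | false | .false | refl

  _∩_ : SubsetN N → SubsetN N → SubsetN N
  (X ∩ Y) x = X x ∧ Y x

  remove : SubsetN N → Fin N → SubsetN N
  remove X y x = X x ∧ not (x ≟F y)

  remove-self : (X : SubsetN N) (y : Fin N) → remove X y y ≡ false
  remove-self X y rewrite ≟F-refl y = ∧-zeroʳ (X y)

  remove-other : (X : SubsetN N) {x y : Fin N} → x ≢ y → remove X y x ≡ X x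
  remove-other X x≢y rewrite ≢⇒≟F-false x≢y = ∧-identityʳ _

  remove-∩-disjoint : (X Q : SubsetN N) {y : Fin N} → Q y ≡ false → (remove X y ∩ Q) ≗ (X ∩ Q)
  remove-∩-disjoint X Q {y} Qy x with x ≟ y
  ... | yes refl rewrite Qy = trans (∧-zeroʳ _) (sym (∧-zeroʳ _))
  ... | no x≢y  = cong (_∧ Q x) (remove-other X x≢y)

  sameSubset-congˡ : {X X′ : SubsetN N} (Y : SubsetN N) → X ≗ X′ → sameSubset X Y ≡ sameSubset X′ Y
  sameSubset-congˡ {X} {X′} Y X≗X′ =
    bool-ext (λ e → sameSubset-true⁺ X′ Y (λ x → trans (sym (X≗X′ x)) (sameSubset-true⁻ X Y e x)))
             (λ e → sameSubset-true⁺ X Y (λ x → trans (X≗X′ x) (sameSubset-true⁻ X′ Y e x)))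

  sameSubset-addPair : {X lam : SubsetN N} {y t : Fin N} → y ≢ t → X y ≡ false → lam y ≡ true → lam t ≡ true →
    not (X t) ∧ sameSubset (λ x → X x ∨ ((y ≟F x) ∨ (t ≟F x))) lam ≡ sameSubset X (remove (remove lam y) t)
  sameSubset-addPair {X} {lam} {y} {t} y≢t Xy ly lt = bool-ext to from
    where
    Z lam′ : SubsetN N
    Z x = X x ∨ ((y ≟F x) ∨ (t ≟F x))
    lam′ = remove (remove lam y) t
    Z-other : ∀ x → x ≢ y → x ≢ t → Z x ≡ X x
    Z-other x x≢y x≢t rewrite ≢⇒≟F-false (≢-sym x≢y) | ≢⇒≟F-false (≢-sym x≢t) = ∨-identityʳ _
    lam′-y : lam′ y ≡ false
    lam′-y = trans (remove-other (remove lam y) y≢t) (remove-self lam y)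
    lam′-other : ∀ x → x ≢ y → x ≢ t → lam′ x ≡ lam x
    lam′-other x x≢y x≢t = trans (remove-other (remove lam y) x≢t) (remove-other lam x≢y)
    to : not (X t) ∧ sameSubset Z lam ≡ true → sameSubset X lam′ ≡ true
    to e = sameSubset-true⁺ X lam′ X≗lam′
      where
      X≗lam′ : X ≗ lam′
      X≗lam′ x with x ≟ y | x ≟ t
      ... | yes refl | _        = trans Xy (sym lam′-y)
      ... | no _     | yes refl = trans (not-injective (proj₁ (∧-true⁻ e))) (sym (remove-self (remove lam y) t))
      ... | no x≢y   | no x≢t   =
        trans (sym (Z-other x x≢y x≢t)) (trans (sameSubset-true⁻ Z lam (proj₂ (∧-true⁻ e)) x) (sym (lam′-other x x≢y x≢t)))
    from : sameSubset X lam′ ≡ true → not (X t) ∧ sameSubset Z lam ≡ true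
    from e = cong₂ _∧_ (cong not (trans (X≗lam′ t) (remove-self (remove lam y) t))) (sameSubset-true⁺ Z lam Z≗lam)
      where
      X≗lam′ : X ≗ lam′
      X≗lam′ = sameSubset-true⁻ X lam′ e
      Z≗lam : Z ≗ lam
      Z≗lam x with x ≟ y | x ≟ t
      ... | yes refl | _        rewrite ≟F-refl y = trans (∨-zeroʳ (X y)) (sym ly)
      ... | no _     | yes refl rewrite ≟F-refl t = trans (cong (X t ∨_) (∨-zeroʳ (y ≟F t))) (trans (∨-zeroʳ (X t)) (sym lt))
      ... | no x≢y   | no x≢t   = trans (Z-other x x≢y x≢t) (trans (X≗lam′ x) (lam′-other x x≢y x≢t))

boolFilter-tabulate-suc : ∀ {n} (p : SubsetN (suc n)) → boolFilter p (tabulate fsuc) ≡ map fsuc (boolFilter (p ∘ fsuc) (allFin n))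
boolFilter-tabulate-suc {n} p = trans (cong (boolFilter p) (sym (map-tabulate id fsuc))) (boolFilter-map p fsuc (allFin n))

module FinFold {c ℓ : Level} (M : CommutativeMonoid c ℓ) where
  open CommutativeMonoid M renaming (refl to ≈-refl; sym to ≈-sym; trans to ≈-trans)
  open import Algebra.Properties.CommutativeSemigroup commutativeSemigroup using (x∙yz≈y∙xz)

  foldFilter : ∀ {n} → (Fin n → Carrier) → SubsetN n → Carrier
  foldFilter F p = foldr _∙_ ε (map F (boolFilter p (allFin _)))

  foldFilter-tabulate-suc : ∀ {n} (F : Fin (suc n) → Carrier) (p : SubsetN (suc n)) →
    foldr _∙_ ε (map F (boolFilter p (tabulate fsuc))) ≡ foldFilter (F ∘ fsuc) (p ∘ fsuc)
  foldFilter-tabulate-suc F p = cong (foldr _∙_ ε) (trans (cong (map F) (boolFilter-tabulate-suc p)) (sym (map-∘ _)))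

  foldFilter-suc : ∀ {n} (F : Fin (suc n) → Carrier) (p : SubsetN (suc n)) →
    foldFilter F p ≡ (if p fzero then F fzero ∙ foldFilter (F ∘ fsuc) (p ∘ fsuc) else foldFilter (F ∘ fsuc) (p ∘ fsuc))
  foldFilter-suc {n} F p with p fzero
  ... | true  = cong (F fzero ∙_) (foldFilter-tabulate-suc F p)
  ... | false = foldFilter-tabulate-suc F p

  foldFilter-cong : ∀ {n} {F G : Fin n → Carrier} {p p′ : SubsetN n} →
    (∀ x → F x ≈ G x) → p ≗ p′ → foldFilter F p ≈ foldFilter G p′
  foldFilter-cong {n} {F} {G} {p} F≈G p≗p′ rewrite boolFilter-cong p≗p′ (allFin n) = go (boolFilter _ (allFin n))
    where
    go : (xs : List (Fin n)) → foldr _∙_ ε (map F xs) ≈ foldr _∙_ ε (map G xs)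
    go []       = ≈-refl
    go (x ∷ xs) = ∙-cong (F≈G x) (go xs)

  foldFilter-extract : ∀ {n} (F : Fin n → Carrier) {p p′ : SubsetN n} (y : Fin n) →
    p y ≡ true → p′ y ≡ false → (∀ x → x ≢ y → p x ≡ p′ x) → foldFilter F p ≈ F y ∙ foldFilter F p′
  foldFilter-extract {suc n} F {p} {p′} fzero py p′y agree
    rewrite foldFilter-suc F p | foldFilter-suc F p′ | py | p′y
    = ∙-congˡ (foldFilter-cong (λ _ → ≈-refl) (λ x → agree (fsuc x) λ ()))
  foldFilter-extract {suc n} F {p} {p′} (fsuc y) py p′y agree
    rewrite foldFilter-suc F p | foldFilter-suc F p′ | agree fzero (λ ())
    with p′ fzero | foldFilter-extract (F ∘ fsuc) y py p′y (λ x x≢y → agree (fsuc x) (x≢y ∘ suc-injective))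
  ... | true  | ih = ≈-trans (∙-congˡ ih) (x∙yz≈y∙xz _ _ _)
  ... | false | ih = ih

  foldFilter-remove : ∀ {n} (F : Fin n → Carrier) (X Q : SubsetN n) {y : Fin n} →
    X y ≡ true → Q y ≡ true → foldFilter F (X ∩ Q) ≈ F y ∙ foldFilter F (remove X y ∩ Q)
  foldFilter-remove F X Q {y} Xy Qy = foldFilter-extract F y (cong₂ _∧_ Xy Qy) (cong (_∧ Q y) (remove-self X y))
    (λ x x≢y → cong (_∧ Q x) (sym (remove-other X x≢y)))

module ℕFold = FinFold ℕ.+-0-commutativeMonoid


length-as-sum : (xs : List A) → length xs ≡ foldr ℕ._+_ 0 (map (λ _ → 1) xs)
length-as-sum []       = refl
length-as-sum (x ∷ xs) = cong suc (length-as-sum xs)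

module _ {n : ℕ} where

  count-as-fold : (p : SubsetN n) → count p (allFin n) ≡ ℕFold.foldFilter (λ _ → 1) p
  count-as-fold p = length-as-sum (boolFilter p (allFin n))

  count-extract : {p p′ : SubsetN n} (y : Fin n) → p y ≡ true → p′ y ≡ false → (∀ x → x ≢ y → p x ≡ p′ x) →
    count p (allFin n) ≡ suc (count p′ (allFin n))
  count-extract {p} {p′} y py p′y agree =
    trans (count-as-fold p) (trans (ℕFold.foldFilter-extract _ y py p′y agree) (cong suc (sym (count-as-fold p′))))

  count-remove : (X Q : SubsetN n) {y : Fin n} → X y ≡ true → Q y ≡ true →
    count (X ∩ Q) (allFin n) ≡ suc (count (remove X y ∩ Q) (allFin n))
  count-remove X Q Xy Qy =
    trans (count-as-fold (X ∩ Q)) (trans (ℕFold.foldFilter-remove _ X Q Xy Qy) (cong suc (sym (count-as-fold _))))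

  count-remove-disjoint : (X Q : SubsetN n) {y : Fin n} → Q y ≡ false →
    count (remove X y ∩ Q) (allFin n) ≡ count (X ∩ Q) (allFin n)
  count-remove-disjoint X Q Qy = count-cong (remove-∩-disjoint X Q Qy) (allFin n)

count-zero : ∀ {n} {p : SubsetN n} → count p (allFin n) ≡ 0 → ∀ x → p x ≡ false
count-zero {p = p} none x with p x in px
... | false = refl
... | true with trans (sym (count-extract x px (remove-self p x) (λ z z≢x → sym (remove-other p z≢x)))) none
... | ()

count-suc : ∀ {n} (p : SubsetN (suc n)) →
  count p (allFin (suc n)) ≡ (if p fzero then suc (count (p ∘ fsuc) (allFin n)) else count (p ∘ fsuc) (allFin n))
count-suc {n} p = trans (count-as-fold p) (trans (ℕFold.foldFilter-suc _ p)
  (cong (λ m → if p fzero then suc m else m) (sym (count-as-fold (p ∘ fsuc)))))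

-- Finite sums and products in a commutative ring; q-integers

module RingSums {c ℓ : Level} (R : CommutativeRing c ℓ) where
  open CommutativeRing R renaming (refl to ≈-refl; sym to ≈-sym; trans to ≈-trans; reflexive to ≈-reflexive)
  open RingOps R
  open import Relation.Binary.Reasoning.Setoid setoid
  open import Algebra.Properties.Ring ring using (-1*x≈-x)
  open import Algebra.Properties.CommutativeSemigroup +-commutativeSemigroup using (interchange)
  module ΣFold = FinFold +-commutativeMonoid
  module ΠFold = FinFold *-commutativeMonoid

  ∑ : (A → Carrier) → List A → Carrier
  ∑ f xs = sumR (map f xs)

  ∏ : (A → Carrier) → List A → Carrier
  ∏ f xs = prodR (map f xs)

  ∑-++ : (f : A → Carrier) (xs ys : List A) → ∑ f (xs ++ ys) ≈ ∑ f xs + ∑ f ys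
  ∑-++ f []       ys = ≈-sym (+-identityˡ _)
  ∑-++ f (x ∷ xs) ys = ≈-trans (+-congˡ (∑-++ f xs ys)) (≈-sym (+-assoc _ _ _))

  ∑-map : (f : B → Carrier) (h : A → B) (xs : List A) → ∑ f (map h xs) ≡ ∑ (f ∘ h) xs
  ∑-map f h []       = refl
  ∑-map f h (x ∷ xs) = cong (f (h x) +_) (∑-map f h xs)

  ∑-congᴬ : {f g : A → Carrier} {xs : List A} → All (λ x → f x ≈ g x) xs → ∑ f xs ≈ ∑ g xs
  ∑-congᴬ []       = ≈-refl
  ∑-congᴬ (e ∷ es) = +-cong e (∑-congᴬ es)

  ∑-cong : {f g : A → Carrier} → (∀ x → f x ≈ g x) → (xs : List A) → ∑ f xs ≈ ∑ g xs
  ∑-cong e xs = ∑-congᴬ (All.universal e xs)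

  ∑-vanish : {f : A → Carrier} {xs : List A} → All (λ x → f x ≈ 0#) xs → ∑ f xs ≈ 0#
  ∑-vanish []       = ≈-refl
  ∑-vanish (e ∷ es) = ≈-trans (+-cong e (∑-vanish es)) (+-identityˡ 0#)

  ∑-+ : (f g : A → Carrier) (xs : List A) → ∑ (λ x → f x + g x) xs ≈ ∑ f xs + ∑ g xs
  ∑-+ f g []       = ≈-sym (+-identityˡ 0#)
  ∑-+ f g (x ∷ xs) = ≈-trans (+-congˡ (∑-+ f g xs)) (interchange _ _ _ _)

  ∑-*ˡ : (a : Carrier) (f : A → Carrier) (xs : List A) → ∑ (λ x → a * f x) xs ≈ a * ∑ f xs
  ∑-*ˡ a f []       = ≈-sym (zeroʳ a)
  ∑-*ˡ a f (x ∷ xs) = ≈-trans (+-congˡ (∑-*ˡ a f xs)) (≈-sym (distribˡ a _ _))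

  ∑-*ʳ : (a : Carrier) (f : A → Carrier) (xs : List A) → ∑ (λ x → f x * a) xs ≈ ∑ f xs * a
  ∑-*ʳ a f []       = ≈-sym (zeroˡ a)
  ∑-*ʳ a f (x ∷ xs) = ≈-trans (+-congˡ (∑-*ʳ a f xs)) (≈-sym (distribʳ a _ _))

  ∑-swap : (F : A → B → Carrier) (xs : List A) (ys : List B) →
    ∑ (λ x → ∑ (F x) ys) xs ≈ ∑ (λ y → ∑ (λ x → F x y) xs) ys
  ∑-swap F []       ys = ≈-sym (∑-vanish (All.universal (λ _ → ≈-refl) ys))
  ∑-swap F (x ∷ xs) ys = ≈-trans (+-congˡ (∑-swap F xs ys)) (≈-sym (∑-+ (F x) _ ys))

  ∑-boolFilter : (f : A → Carrier) (p : A → Bool) (xs : List A) →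
    ∑ f (boolFilter p xs) ≈ ∑ (λ x → if p x then f x else 0#) xs
  ∑-boolFilter f p []       = ≈-refl
  ∑-boolFilter f p (x ∷ xs) with p x
  ... | true  = +-congˡ (∑-boolFilter f p xs)
  ... | false = ≈-trans (∑-boolFilter f p xs) (≈-sym (+-identityˡ _))

  ∑-boolFilter-if : (r p : A → Bool) (f : A → Carrier) (xs : List A) →
    ∑ (λ x → if r x then f x else 0#) (boolFilter p xs) ≈ ∑ f (boolFilter (λ x → r x ∧ p x) xs)
  ∑-boolFilter-if r p f xs =
    ≈-trans (∑-boolFilter _ p xs) (≈-trans (∑-cong (λ x → if-if (p x) (r x)) xs) (≈-sym (∑-boolFilter f _ xs)))
    where
    if-if : ∀ {v} a b → (if a then (if b then v else 0#) else 0#) ≈ (if b ∧ a then v else 0#)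
    if-if true  true  = ≈-refl
    if-if true  false = ≈-refl
    if-if false true  = ≈-refl
    if-if false false = ≈-refl

  ∏-congᴬ : {f g : A → Carrier} {xs : List A} → All (λ x → f x ≈ g x) xs → ∏ f xs ≈ ∏ g xs
  ∏-congᴬ []       = ≈-refl
  ∏-congᴬ (e ∷ es) = *-cong e (∏-congᴬ es)

  sublists-All : {P : A → Set} {xs : List A} → All P xs → All (All P) (sublists xs)
  sublists-All []         = [] ∷ []
  sublists-All (px ∷ pxs) = Allₚ.++⁺ rest (Allₚ.map⁺ (All.map (px ∷_) rest))
    where rest = sublists-All pxs

  ∑-sublists-++ : (G : List A → Carrier) (xs ys : List A) →
    ∑ G (sublists (xs ++ ys)) ≈ ∑ (λ α → ∑ (λ β → G (α ++ β)) (sublists ys)) (sublists xs)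
  ∑-sublists-++ G []       ys = ≈-sym (+-identityʳ _)
  ∑-sublists-++ G (x ∷ xs) ys = begin
      ∑ G (sublists (xs ++ ys) ++ map (x ∷_) (sublists (xs ++ ys)))
    ≈⟨ ∑-++ G (sublists (xs ++ ys)) (map (x ∷_) (sublists (xs ++ ys))) ⟩
      ∑ G (sublists (xs ++ ys)) + ∑ G (map (x ∷_) (sublists (xs ++ ys)))
    ≈⟨ +-cong (∑-sublists-++ G xs ys)
              (≈-trans (≈-reflexive (∑-map G (x ∷_) (sublists (xs ++ ys)))) (∑-sublists-++ (G ∘ (x ∷_)) xs ys)) ⟩
      ∑ H (sublists xs) + ∑ (H ∘ (x ∷_)) (sublists xs)
    ≈⟨ +-congˡ (≈-reflexive (sym (∑-map H (x ∷_) (sublists xs)))) ⟩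
      ∑ H (sublists xs) + ∑ H (map (x ∷_) (sublists xs))
    ≈⟨ ≈-sym (∑-++ H (sublists xs) (map (x ∷_) (sublists xs))) ⟩
      ∑ H (sublists xs ++ map (x ∷_) (sublists xs))
    ∎
    where H = λ α → ∑ (λ β → G (α ++ β)) (sublists ys)

  ∑-sublists-cons : (G : List A → Carrier) (x : A) (xs : List A) →
    ∑ G (sublists (x ∷ xs)) ≈ ∑ G (sublists xs) + ∑ (G ∘ (x ∷_)) (sublists xs)
  ∑-sublists-cons G x xs =
    ≈-trans (∑-++ G (sublists xs) (map (x ∷_) (sublists xs))) (+-congˡ (≈-reflexive (∑-map G (x ∷_) (sublists xs))))

  ∑-sublists-empty : {P : A → Set} (h : List A → Carrier) {xs : List A} → All P xs →
    (∀ {c} γ → P c → h (c ∷ γ) ≈ 0#) → ∑ h (sublists xs) ≈ h []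
  ∑-sublists-empty h []         _     = +-identityʳ _
  ∑-sublists-empty h {x ∷ xs} (px ∷ pxs) vanish = begin
      ∑ h (sublists (x ∷ xs))
    ≈⟨ ∑-sublists-cons h x xs ⟩
      ∑ h (sublists xs) + ∑ (h ∘ (x ∷_)) (sublists xs)
    ≈⟨ +-cong (∑-sublists-empty h pxs vanish) (∑-vanish (All.universal (λ γ → vanish γ px) (sublists xs))) ⟩
      h [] + 0#
    ≈⟨ +-identityʳ _ ⟩
      h []
    ∎

  ∑-sublists-atMostOne : {P : A → Set} (h : List A → Carrier) {xs : List A} → All P xs →
    (∀ {c₁ c₂} γ → P c₁ → P c₂ → h (c₁ ∷ c₂ ∷ γ) ≈ 0#) → ∑ h (sublists xs) ≈ h [] + ∑ (λ c → h (c ∷ [])) xs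
  ∑-sublists-atMostOne h []         _     = ≈-refl
  ∑-sublists-atMostOne h {x ∷ xs} (px ∷ pxs) vanish = begin
      ∑ h (sublists (x ∷ xs))
    ≈⟨ ∑-sublists-cons h x xs ⟩
      ∑ h (sublists xs) + ∑ (h ∘ (x ∷_)) (sublists xs)
    ≈⟨ +-cong (∑-sublists-atMostOne h pxs vanish) (∑-sublists-empty (h ∘ (x ∷_)) pxs (λ γ pc → vanish γ px pc)) ⟩
      (h [] + ∑ (λ c → h (c ∷ [])) xs) + h (x ∷ [])
    ≈⟨ +-assoc _ _ _ ⟩
      h [] + (∑ (λ c → h (c ∷ [])) xs + h (x ∷ []))
    ≈⟨ +-congˡ (+-comm _ _) ⟩
      h [] + ∑ (λ c → h (c ∷ [])) (x ∷ xs)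
    ∎

  pow-+ : ∀ x a b → pow x (a ℕ.+ b) ≈ pow x a * pow x b
  pow-+ x zero    b = ≈-sym (*-identityˡ _)
  pow-+ x (suc a) b = ≈-trans (*-congˡ (pow-+ x a b)) (≈-sym (*-assoc _ _ _))

  module _ (q : Carrier) where

    qInt : ℕ → Carrier
    qInt zero    = 0#
    qInt (suc k) = pow q k + qInt k

    qInt-telescopes : ∀ k → (q + - 1#) * qInt k ≈ pow q k + - 1#
    qInt-telescopes zero    = ≈-trans (zeroʳ _) (≈-sym (-‿inverseʳ 1#))
    qInt-telescopes (suc k) = begin
        (q + - 1#) * (pow q k + qInt k)
      ≈⟨ distribˡ _ _ _ ⟩
        (q + - 1#) * pow q k + (q + - 1#) * qInt k
      ≈⟨ +-cong (distribʳ _ _ _) (qInt-telescopes k) ⟩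
        (q * pow q k + - 1# * pow q k) + (pow q k + - 1#)
      ≈⟨ +-congʳ (+-congˡ (-1*x≈-x _)) ⟩
        (q * pow q k + - pow q k) + (pow q k + - 1#)
      ≈⟨ +-assoc _ _ _ ⟩
        q * pow q k + (- pow q k + (pow q k + - 1#))
      ≈⟨ +-congˡ (≈-trans (≈-sym (+-assoc _ _ _)) (≈-trans (+-congʳ (-‿inverseˡ _)) (+-identityˡ _))) ⟩
        q * pow q k + - 1#
      ∎

    qInt-as-quotient : ∀ {u} → (q + - 1#) * u ≈ 1# → ∀ k → (pow q k + - 1#) * u ≈ qInt k
    qInt-as-quotient {u} inverse k = begin
        (pow q k + - 1#) * u
      ≈⟨ *-congʳ (≈-sym (qInt-telescopes k)) ⟩
        ((q + - 1#) * qInt k) * u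
      ≈⟨ *-congʳ (*-comm _ _) ⟩
        (qInt k * (q + - 1#)) * u
      ≈⟨ *-assoc _ _ _ ⟩
        qInt k * ((q + - 1#) * u)
      ≈⟨ *-congˡ inverse ⟩
        qInt k * 1#
      ≈⟨ *-identityʳ _ ⟩
        qInt k
      ∎

    ∑-pow-larger≈qInt : ∀ {n} (r : SubsetN n) →
      ∑ (λ t → pow q (count (λ z → r z ∧ (t <F z)) (allFin n))) (boolFilter r (allFin n)) ≈ qInt (count r (allFin n))
    ∑-pow-larger≈qInt {zero}  r = ≈-refl
    ∑-pow-larger≈qInt {suc n} r = begin
        ΣFold.foldFilter F r
      ≡⟨ ΣFold.foldFilter-suc F r ⟩
        (if r fzero then F fzero + ΣFold.foldFilter (F ∘ fsuc) (r ∘ fsuc) else ΣFold.foldFilter (F ∘ fsuc) (r ∘ fsuc))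
      ≈⟨ split (r fzero) ⟩
        (if r fzero then pow q m + qInt m else qInt m)
      ≡⟨ qInt-if (r fzero) ⟩
        qInt (if r fzero then suc m else m)
      ≡⟨ cong qInt (sym (count-suc r)) ⟩
        qInt (count r (allFin (suc n)))
      ∎
      where
      F : Fin (suc n) → Carrier
      F t = pow q (count (λ z → r z ∧ (t <F z)) (allFin (suc n)))
      m : ℕ
      m = count (r ∘ fsuc) (allFin n)
      larger-fzero : count (λ z → r z ∧ (fzero <F z)) (allFin (suc n)) ≡ m
      larger-fzero rewrite count-suc (λ z → r z ∧ (fzero <F z)) | ∧-zeroʳ (r fzero) =
        count-cong (λ z → ∧-identityʳ (r (fsuc z))) (allFin n)
      larger-fsuc : ∀ t → count (λ z → r z ∧ (fsuc t <F z)) (allFin (suc n)) ≡ count (λ z → r (fsuc z) ∧ (t <F z)) (allFin n)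
      larger-fsuc t rewrite count-suc (λ z → r z ∧ (fsuc t <F z)) | ∧-zeroʳ (r fzero) = refl
      rest : ΣFold.foldFilter (F ∘ fsuc) (r ∘ fsuc) ≈ qInt m
      rest = ≈-trans (ΣFold.foldFilter-cong (λ t → ≈-reflexive (cong (pow q) (larger-fsuc t))) (λ _ → refl))
                     (∑-pow-larger≈qInt (r ∘ fsuc))
      split : ∀ b → (if b then F fzero + ΣFold.foldFilter (F ∘ fsuc) (r ∘ fsuc) else ΣFold.foldFilter (F ∘ fsuc) (r ∘ fsuc))
                    ≈ (if b then pow q m + qInt m else qInt m)
      split true  = +-cong (≈-reflexive (cong (pow q) larger-fzero)) rest
      split false = rest
      qInt-if : ∀ b → (if b then pow q m + qInt m else qInt m) ≡ qInt (if b then suc m else m)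
      qInt-if true  = refl
      qInt-if false = refl

-- Inversions, rook placements and their types

module _ {N : ℕ} where

  inverted : Cell N → Cell N → Bool
  inverted c c′ = (proj₁ c′ <F proj₁ c) ∧ (proj₂ c <F proj₂ c′)

  crossings : List (Cell N) → List (Cell N) → ℕ
  crossings σ = foldr (λ c acc → count (inverted c) σ ℕ.+ acc) 0

  crossings-++ : (σ xs ys : List (Cell N)) → crossings σ (xs ++ ys) ≡ crossings σ xs ℕ.+ crossings σ ys
  crossings-++ σ []       ys = refl
  crossings-++ σ (x ∷ xs) ys =
    trans (cong (count (inverted x) σ ℕ.+_) (crossings-++ σ xs ys)) (sym (ℕ.+-assoc (count (inverted x) σ) (crossings σ xs) (crossings σ ys)))

  crossings-congᴬ : {σ σ′ xs : List (Cell N)} → All (λ d → count (inverted d) σ ≡ count (inverted d) σ′) xs →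
    crossings σ xs ≡ crossings σ′ xs
  crossings-congᴬ []       = refl
  crossings-congᴬ {σ} {σ′} (e ∷ es) = cong₂ ℕ._+_ e (crossings-congᴬ {σ} {σ′} es)

  inv-snoc : (α : List (Cell N)) (c : Cell N) → All (λ d → proj₁ d < proj₁ c) α →
    inv (α ++ c ∷ []) ≡ inv α ℕ.+ count (λ d → proj₂ c <F proj₂ d) α
  inv-snoc α c below = begin
      inv (α ++ c ∷ [])
    ≡⟨⟩
      crossings (α ++ c ∷ []) (α ++ c ∷ [])
    ≡⟨ crossings-++ (α ++ c ∷ []) α (c ∷ []) ⟩
      crossings (α ++ c ∷ []) α ℕ.+ (count (inverted c) (α ++ c ∷ []) ℕ.+ 0)
    ≡⟨ cong₂ ℕ._+_ (crossings-congᴬ {α ++ c ∷ []} {α} (All.map earlier below)) (ℕ.+-identityʳ _) ⟩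
      crossings α α ℕ.+ count (inverted c) (α ++ c ∷ [])
    ≡⟨ cong (crossings α α ℕ.+_) last ⟩
      inv α ℕ.+ count (λ d → proj₂ c <F proj₂ d) α
    ∎
    where
    open ≡-Reasoning
    earlier : ∀ {d} → proj₁ d < proj₁ c → count (inverted d) (α ++ c ∷ []) ≡ count (inverted d) α
    earlier {d} d<c rewrite count-++ (inverted d) α (c ∷ []) | >⇒<F-false {x = proj₁ c} {y = proj₁ d} d<c = ℕ.+-identityʳ _
    last : count (inverted c) (α ++ c ∷ []) ≡ count (λ d → proj₂ c <F proj₂ d) α
    last rewrite count-++ (inverted c) α (c ∷ []) | <F-irrefl (proj₁ c) =
      trans (ℕ.+-identityʳ _) (count-congᴬ (All.map (λ {d} d<c → cong (_∧ (proj₂ c <F proj₂ d)) (<⇒<F d<c)) below))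

  nonAttacking : Cell N → Cell N → Bool
  nonAttacking c d = not (proj₁ d ≟F proj₁ c) ∧ not (proj₂ d ≟F proj₂ c)

  nonAttacking-sym : (c d : Cell N) → nonAttacking c d ≡ nonAttacking d c
  nonAttacking-sym c d = cong₂ (λ a b → not a ∧ not b) (≟F-sym (proj₁ d) (proj₁ c)) (≟F-sym (proj₂ d) (proj₂ c))

  nonAttacking-true⁻ : {c d : Cell N} → nonAttacking c d ≡ true → proj₁ d ≢ proj₁ c × proj₂ d ≢ proj₂ c
  nonAttacking-true⁻ {c} {d} na with proj₁ d ≟F proj₁ c in e₁ | proj₂ d ≟F proj₂ c in e₂
  ... | false | false = ≟F-false⇒≢ e₁ , ≟F-false⇒≢ e₂
  nonAttacking-true⁻ () | true  | _
  nonAttacking-true⁻ () | false | true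

  isRook-snoc : (α : List (Cell N)) (c : Cell N) → isRook (α ++ c ∷ []) ≡ isRook α ∧ allB (nonAttacking c) α
  isRook-snoc []      c = refl
  isRook-snoc (a ∷ α) c = begin
      allB (nonAttacking a) (α ++ c ∷ []) ∧ isRook (α ++ c ∷ [])
    ≡⟨ cong₂ _∧_ (allB-++ (nonAttacking a) α (c ∷ [])) (isRook-snoc α c) ⟩
      (allB (nonAttacking a) α ∧ (nonAttacking a c ∧ true)) ∧ (isRook α ∧ allB (nonAttacking c) α)
    ≡⟨ cong (λ b → (allB (nonAttacking a) α ∧ b) ∧ (isRook α ∧ allB (nonAttacking c) α))
            (trans (∧-identityʳ _) (nonAttacking-sym a c)) ⟩
      (allB (nonAttacking a) α ∧ nonAttacking c a) ∧ (isRook α ∧ allB (nonAttacking c) α)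
    ≡⟨ ∧-interchange (allB (nonAttacking a) α) (nonAttacking c a) (isRook α) (allB (nonAttacking c) α) ⟩
      (allB (nonAttacking a) α ∧ isRook α) ∧ (nonAttacking c a ∧ allB (nonAttacking c) α)
    ∎
    where open ≡-Reasoning

  isRook-sameRow : (α : List (Cell N)) (c₁ c₂ : Cell N) (γ : List (Cell N)) →
    proj₁ c₁ ≡ proj₁ c₂ → isRook (α ++ c₁ ∷ c₂ ∷ γ) ≡ false
  isRook-sameRow []      c₁ c₂ γ same rewrite same | ≟F-refl (proj₁ c₂) = refl
  isRook-sameRow (a ∷ α) c₁ c₂ γ same rewrite isRook-sameRow α c₁ c₂ γ same = ∧-zeroʳ _

  typeOf-snoc : (α : List (Cell N)) (c : Cell N) (x : Fin N) →
    typeOf (α ++ c ∷ []) x ≡ typeOf α x ∨ ((proj₁ c ≟F x) ∨ (proj₂ c ≟F x))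
  typeOf-snoc α c x = trans (anyB-++ _ α (c ∷ [])) (cong (typeOf α x ∨_) (∨-identityʳ _))

  typeOf-snoc-first : (α : List (Cell N)) (c : Cell N) → typeOf (α ++ c ∷ []) (proj₁ c) ≡ true
  typeOf-snoc-first α c rewrite typeOf-snoc α c (proj₁ c) | ≟F-refl (proj₁ c) = ∨-zeroʳ _

  typeOf-snoc-second : (α : List (Cell N)) (c : Cell N) → typeOf (α ++ c ∷ []) (proj₂ c) ≡ true
  typeOf-snoc-second α c rewrite typeOf-snoc α c (proj₂ c) | ≟F-refl (proj₂ c) | ∨-zeroʳ (proj₁ c ≟F proj₂ c) = ∨-zeroʳ _

-- Rook placements on the board B_μ

module Board {N : ℕ} (μ : Word N) where

  OnBoard : Cell N → Set
  OnBoard d = inS μ (proj₁ d) ≡ true × inT μ (proj₂ d) ≡ true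

  BelowRow : Fin N → Cell N → Set
  BelowRow y d = proj₁ d < y × OnBoard d

  inS⇒inT-false : {x : Fin N} → inS μ x ≡ true → inT μ x ≡ false
  inS⇒inT-false {x} sx with μ x
  ... | false = refl

  inT⇒inS-false : {x : Fin N} → inT μ x ≡ true → inS μ x ≡ false
  inT⇒inS-false tx rewrite tx = refl

  S≢T : {x y : Fin N} → inS μ x ≡ true → inT μ y ≡ true → x ≢ y
  S≢T sx ty refl with trans (sym (inS⇒inT-false sx)) ty
  ... | ()

  typeOf-below : {y : Fin N} {α : List (Cell N)} → inS μ y ≡ true → All (BelowRow y) α → typeOf α y ≡ false
  typeOf-below {y} y∈S below = anyB-false⁺ _ (All.map avoid below)
    where
    avoid : ∀ {d} → BelowRow y d → ((proj₁ d ≟F y) ∨ (proj₂ d ≟F y)) ≡ false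
    avoid (d<y , _ , td) = cong₂ _∨_ (≢⇒≟F-false (<⇒≢ d<y)) (≢⇒≟F-false (≢-sym (S≢T y∈S td)))

  allB-nonAttacking-below : {y t : Fin N} {α : List (Cell N)} → All (BelowRow y) α → inT μ t ≡ true →
    allB (nonAttacking (y , t)) α ≡ not (typeOf α t)
  allB-nonAttacking-below {y} {t} {α} below t∈T = trans (allB-congᴬ (All.map agree below)) (allB-not _ α)
    where
    agree : ∀ {d} → BelowRow y d → nonAttacking (y , t) d ≡ not ((proj₁ d ≟F t) ∨ (proj₂ d ≟F t))
    agree (d<y , sd , _) rewrite ≢⇒≟F-false (<⇒≢ d<y) | ≢⇒≟F-false (S≢T sd t∈T) = refl

  count-secondCoords : (α : List (Cell N)) → isRook α ≡ true → All OnBoard α → (p : Fin N → Bool) →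
    count (p ∘ proj₂) α ≡ count (λ z → typeOf α z ∧ (inT μ z ∧ p z)) (allFin N)
  count-secondCoords []      _    []              p = sym (cong length (boolFilter-none (allFin N)))
  count-secondCoords (d ∷ α) rook ((sd , td) ∷ oα) p = begin
      count (p ∘ proj₂) (d ∷ α)
    ≡⟨ count-cons (p ∘ proj₂) d α ⟩
      (if p (proj₂ d) then suc (count (p ∘ proj₂) α) else count (p ∘ proj₂) α)
    ≡⟨ cong (λ m → if p (proj₂ d) then suc m else m) (count-secondCoords α (proj₂ (∧-true⁻ rook)) oα p) ⟩
      (if p (proj₂ d) then suc (count g (allFin N)) else count g (allFin N))
    ≡⟨ extend (p (proj₂ d)) refl ⟩
      count f (allFin N)
    ∎
    where
    open ≡-Reasoning
    f g : Fin N → Bool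
    f z = typeOf (d ∷ α) z ∧ (inT μ z ∧ p z)
    g z = typeOf α z ∧ (inT μ z ∧ p z)
    fresh : typeOf α (proj₂ d) ≡ false
    fresh = anyB-false⁺ _ (All.zipWith avoid (allB-true⁻ _ α (proj₁ (∧-true⁻ rook)) , oα))
      where
      avoid : ∀ {d′} → nonAttacking d d′ ≡ true × OnBoard d′ →
        ((proj₁ d′ ≟F proj₂ d) ∨ (proj₂ d′ ≟F proj₂ d)) ≡ false
      avoid {d′} (na , sd′ , _) =
        cong₂ _∨_ (≢⇒≟F-false (S≢T sd′ td)) (≢⇒≟F-false (proj₂ (nonAttacking-true⁻ {c = d} {d = d′} na)))
    gd : g (proj₂ d) ≡ false
    gd rewrite fresh = refl
    agree : ∀ z → z ≢ proj₂ d → f z ≡ g z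
    agree z z≢d with inT μ z in tz
    ... | false = trans (∧-zeroʳ _) (sym (∧-zeroʳ _))
    ... | true rewrite ≢⇒≟F-false (S≢T sd tz) | ≢⇒≟F-false (≢-sym z≢d) = refl
    extend : ∀ b → p (proj₂ d) ≡ b → (if b then suc (count g (allFin N)) else count g (allFin N)) ≡ count f (allFin N)
    extend true  pd = sym (count-extract (proj₂ d) fd gd agree)
      where
      fd : f (proj₂ d) ≡ true
      fd rewrite ≟F-refl (proj₂ d) | ∨-zeroʳ (proj₁ d ≟F proj₂ d) | td | pd = refl
    extend false pd = sym (count-cong f≗g (allFin N))
      where
      f≗g : f ≗ g
      f≗g z with z ≟ proj₂ d
      ... | yes refl rewrite td | pd = trans (∧-zeroʳ _) (sym (∧-zeroʳ _))
      ... | no z≢d = agree z z≢d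

  row : Fin N → List (Cell N)
  row s = boolFilter (inB μ) (map (s ,_) (allFin N))

  rows : List (Fin N) → List (Cell N)
  rows = concatMap row

  board≡rows : board μ ≡ rows (allFin N)
  board≡rows = boolFilter-concatMap (inB μ) (λ s → map (s ,_) (allFin N)) (allFin N)

  rows-∷ʳ : (xs : List (Fin N)) (y : Fin N) → rows (xs ∷ʳ y) ≡ rows xs ++ row y
  rows-∷ʳ xs y = trans (concatMap-++ row xs (y ∷ [])) (cong (rows xs ++_) (++-identityʳ (row y)))

  inB⁻ : {d : Cell N} → inB μ d ≡ true → OnBoard d × proj₁ d < proj₂ d
  inB⁻ {s , t} e with inS μ s | inT μ t | s <F t in s<t
  ... | true  | true  | true = (refl , refl) , <F⇒< s<t
  inB⁻ {s , t} () | false | _     | _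
  inB⁻ {s , t} () | true  | false | _
  inB⁻ {s , t} () | true  | true  | false

  row-All : (s : Fin N) → All (λ d → proj₁ d ≡ s × inB μ d ≡ true) (row s)
  row-All s = boolFilter-All (inB μ) (Allₚ.map⁺ (All.universal (λ _ → refl) (allFin N)))

  rows-below : {y : Fin N} (xs : List (Fin N)) → All (_< y) xs → All (BelowRow y) (rows xs)
  rows-below     []       []           = []
  rows-below {y} (s ∷ xs) (s<y ∷ xs<y) = Allₚ.++⁺ (All.map below (row-All s)) (rows-below xs xs<y)
    where
    below : ∀ {d} → proj₁ d ≡ s × inB μ d ≡ true → BelowRow y d
    below (refl , e) = s<y , proj₁ (inB⁻ e)

  countAbove : SubsetN N → Fin N → ℕ
  countAbove lam t = count (lam ∩ λ z → inT μ z ∧ (t <F z)) (allFin N)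

  Balanced : SubsetN N → Set
  Balanced lam = length (lamS μ lam) ≡ length (lamT μ lam)

  half-card : {lam : SubsetN N} → Balanced lam → card lam / 2 ≡ length (lamS μ lam)
  half-card {lam} balanced = begin
      count lam (allFin N) / 2
    ≡⟨ cong (_/ 2) (count-split lam μ (allFin N)) ⟩
      (n ℕ.+ length (lamT μ lam)) / 2
    ≡⟨ cong (λ m → (n ℕ.+ m) / 2) (trans (sym balanced) (sym (ℕ.+-identityʳ n))) ⟩
      (2 ℕ.* n) / 2
    ≡⟨ cong (_/ 2) (ℕ.*-comm 2 n) ⟩
      (n ℕ.* 2) / 2
    ≡⟨ m*n/n≡m n 2 ⟩
      n
    ∎
    where
    open ≡-Reasoning
    n = length (lamS μ lam)

  rho-top : {lam : SubsetN N} {y : Fin N} → Balanced lam → inS μ y ≡ true →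
    (∀ x → (lam ∩ inS μ) x ≡ true → toℕ x ℕ.≤ toℕ y) →
    rho y μ lam ≡ countAbove lam y
  rho-top {lam} {y} balanced y∈S top = begin
      (count (lam ∩ λ x → inS μ x ∧ ((x <F y) ∨ (x ≟F y))) (allFin N)
         ℕ.+ count (lam ∩ λ x → inT μ x ∧ ((y <F x) ∨ (x ≟F y))) (allFin N)) ∸ (card lam / 2)
    ≡⟨ cong₂ (λ a b → (a ℕ.+ b) ∸ (card lam / 2)) (count-cong belowTop (allFin N)) (count-cong aboveTop (allFin N)) ⟩
      (length (lamS μ lam) ℕ.+ k) ∸ (card lam / 2)
    ≡⟨ cong (λ m → (length (lamS μ lam) ℕ.+ k) ∸ m) (half-card balanced) ⟩
      (length (lamS μ lam) ℕ.+ k) ∸ length (lamS μ lam)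
    ≡⟨ ℕ.m+n∸m≡n (length (lamS μ lam)) k ⟩
      k
    ∎
    where
    open ≡-Reasoning
    k = countAbove lam y
    belowTop : ∀ x → lam x ∧ (inS μ x ∧ ((x <F y) ∨ (x ≟F y))) ≡ lam x ∧ inS μ x
    belowTop x with lam x in x∈λ | inS μ x in x∈S
    ... | false | _     = refl
    ... | true  | false = refl
    ... | true  | true  = ≤⇒≤F (top x (cong₂ _∧_ x∈λ x∈S))
    aboveTop : ∀ x → lam x ∧ (inT μ x ∧ ((y <F x) ∨ (x ≟F y))) ≡ lam x ∧ (inT μ x ∧ (y <F x))
    aboveTop x with inT μ x in x∈T
    ... | false = refl
    ... | true rewrite ≢⇒≟F-false (≢-sym (S≢T y∈S x∈T)) = cong (lam x ∧_) (∨-identityʳ _)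

  module AddRook {lam : SubsetN N} {y t : Fin N} (y∈S : inS μ y ≡ true) (t∈T : inT μ t ≡ true) (y<t : y < t)
                 (y∈λ : lam y ≡ true) (t∈λ : lam t ≡ true) where

    lam′ : SubsetN N
    lam′ = remove (remove lam y) t

    y≢t : y ≢ t
    y≢t = S≢T y∈S t∈T

    y∉T : inT μ y ≡ false
    y∉T = inS⇒inT-false y∈S

    t∉S : inS μ t ≡ false
    t∉S = inT⇒inS-false t∈T

    lamS-lam′ : lamS μ lam′ ≡ boolFilter (remove lam y ∩ inS μ) (allFin N)
    lamS-lam′ = boolFilter-cong (remove-∩-disjoint (remove lam y) (inS μ) t∉S) (allFin N)

    length-lamS : length (lamS μ lam) ≡ suc (length (lamS μ lam′))
    length-lamS = trans (count-remove lam (inS μ) y∈λ y∈S) (cong (suc ∘ length) (sym lamS-lam′))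

    length-lamT : length (lamT μ lam) ≡ suc (length (lamT μ lam′))
    length-lamT = trans (sym (count-remove-disjoint lam (inT μ) y∉T))
                        (count-remove (remove lam y) (inT μ) (trans (remove-other lam (≢-sym y≢t)) t∈λ) t∈T)

    balanced′ : Balanced lam → Balanced lam′
    balanced′ balanced = ℕ.suc-injective (trans (sym length-lamS) (trans balanced length-lamT))

    rho-lam′ : Balanced lam → (x : Fin N) → x < y → rho x μ lam′ ≡ rho x μ lam
    rho-lam′ balanced x x<y = begin
        (count (lam′ ∩ Le) (allFin N) ℕ.+ count (lam′ ∩ Ge) (allFin N)) ∸ (card lam′ / 2)
      ≡⟨ cong₂ (λ a m → (a ℕ.+ count (lam′ ∩ Ge) (allFin N)) ∸ m) sameBelow (half-card (balanced′ balanced)) ⟩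
        (count (lam ∩ Le) (allFin N) ℕ.+ count (lam′ ∩ Ge) (allFin N)) ∸ length (lamS μ lam′)
      ≡⟨ cong (_∸ suc (length (lamS μ lam′))) (sym (ℕ.+-suc (count (lam ∩ Le) (allFin N)) (count (lam′ ∩ Ge) (allFin N)))) ⟩
        (count (lam ∩ Le) (allFin N) ℕ.+ suc (count (lam′ ∩ Ge) (allFin N))) ∸ suc (length (lamS μ lam′))
      ≡⟨ cong₂ (λ b m → (count (lam ∩ Le) (allFin N) ℕ.+ b) ∸ m)
               (sym oneMoreAbove) (trans (sym length-lamS) (sym (half-card balanced))) ⟩
        (count (lam ∩ Le) (allFin N) ℕ.+ count (lam ∩ Ge) (allFin N)) ∸ (card lam / 2)
      ∎
      where
      open ≡-Reasoning
      Le Ge : SubsetN N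
      Le z = inS μ z ∧ ((z <F x) ∨ (z ≟F x))
      Ge z = inT μ z ∧ ((x <F z) ∨ (z ≟F x))
      sameBelow : count (lam′ ∩ Le) (allFin N) ≡ count (lam ∩ Le) (allFin N)
      sameBelow = trans (count-remove-disjoint (remove lam y) Le (cong (_∧ _) t∉S))
                        (count-remove-disjoint lam Le (trans (cong (inS μ y ∧_) y≰x) (∧-zeroʳ _)))
        where
        y≰x : ((y <F x) ∨ (y ≟F x)) ≡ false
        y≰x = cong₂ _∨_ (>⇒<F-false x<y) (≢⇒≟F-false (≢-sym (<⇒≢ x<y)))
      oneMoreAbove : count (lam ∩ Ge) (allFin N) ≡ suc (count (lam′ ∩ Ge) (allFin N))
      oneMoreAbove = trans (sym (count-remove-disjoint lam Ge (cong (_∧ _) y∉T)))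
                           (count-remove (remove lam y) Ge (trans (remove-other lam (≢-sym y≢t)) t∈λ)
                                         (cong₂ _∧_ t∈T (cong (_∨ (t ≟F x)) (<⇒<F (ℕ.<-trans x<y y<t)))))

    placement-addRook : (α : List (Cell N)) → All (BelowRow y) α →
      (isRook (α ++ (y , t) ∷ []) ∧ sameSubset (typeOf (α ++ (y , t) ∷ [])) lam) ≡ (isRook α ∧ sameSubset (typeOf α) lam′)
    placement-addRook α below = begin
        isRook (α ++ (y , t) ∷ []) ∧ sameSubset (typeOf (α ++ (y , t) ∷ [])) lam
      ≡⟨ cong₂ _∧_ (trans (isRook-snoc α (y , t)) (cong (isRook α ∧_) (allB-nonAttacking-below below t∈T)))
                   (sameSubset-congˡ lam (typeOf-snoc α (y , t))) ⟩
        (isRook α ∧ not (typeOf α t)) ∧ sameSubset (λ x → typeOf α x ∨ ((y ≟F x) ∨ (t ≟F x))) lam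
      ≡⟨ ∧-assoc (isRook α) _ _ ⟩
        isRook α ∧ (not (typeOf α t) ∧ sameSubset (λ x → typeOf α x ∨ ((y ≟F x) ∨ (t ≟F x))) lam)
      ≡⟨ cong (isRook α ∧_) (sameSubset-addPair y≢t (typeOf-below y∈S below) y∈λ t∈λ) ⟩
        isRook α ∧ sameSubset (typeOf α) lam′
      ∎
      where open ≡-Reasoning

    inv-addRook : (α : List (Cell N)) → All (BelowRow y) α → isRook α ≡ true → typeOf α ≗ lam′ →
      inv (α ++ (y , t) ∷ []) ≡ inv α ℕ.+ countAbove lam t
    inv-addRook α below rook type≗lam′ = begin
        inv (α ++ (y , t) ∷ [])
      ≡⟨ inv-snoc α (y , t) (All.map proj₁ below) ⟩
        inv α ℕ.+ count ((t <F_) ∘ proj₂) α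
      ≡⟨ cong (inv α ℕ.+_) (count-secondCoords α rook (All.map proj₂ below) (t <F_)) ⟩
        inv α ℕ.+ count (typeOf α ∩ Above) (allFin N)
      ≡⟨ cong (inv α ℕ.+_) (count-cong (λ z → cong (_∧ Above z) (type≗lam′ z)) (allFin N)) ⟩
        inv α ℕ.+ count (lam′ ∩ Above) (allFin N)
      ≡⟨ cong (inv α ℕ.+_) (trans (count-remove-disjoint (remove lam y) Above (trans (cong (inT μ t ∧_) (<F-irrefl t)) (∧-zeroʳ _)))
                                  (count-remove-disjoint lam Above (cong (_∧ (t <F y)) y∉T))) ⟩
        inv α ℕ.+ countAbove lam t
      ∎
      where
      open ≡-Reasoning
      Above : SubsetN N
      Above z = inT μ z ∧ (t <F z)

-- The weighted sum over rook placements, row by row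

module RookSums {c ℓ : Level} (R : CommutativeRing c ℓ) {N : ℕ} (μ : Word N) (q : CommutativeRing.Carrier R) where
  open CommutativeRing R renaming (refl to ≈-refl; sym to ≈-sym; trans to ≈-trans; reflexive to ≈-reflexive)
  open RingOps R
  open RingSums R
  open Board μ
  open import Relation.Binary.Reasoning.Setoid setoid

  weight : SubsetN N → List (Cell N) → Carrier
  weight lam σ = if isRook σ ∧ sameSubset (typeOf σ) lam then pow q (inv σ) else 0#

  weight-wrongType : (lam : SubsetN N) (σ : List (Cell N)) (x : Fin N) → typeOf σ x ≢ lam x → weight lam σ ≈ 0#
  weight-wrongType lam σ x wrong with sameSubset (typeOf σ) lam in same
  ... | true  = ⊥-elim (wrong (sameSubset-true⁻ (typeOf σ) lam same x))
  ... | false rewrite ∧-zeroʳ (isRook σ) = ≈-refl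

  weight-sameRow : (lam : SubsetN N) (α : List (Cell N)) (c₁ c₂ : Cell N) (γ : List (Cell N)) →
    proj₁ c₁ ≡ proj₁ c₂ → weight lam (α ++ c₁ ∷ c₂ ∷ γ) ≈ 0#
  weight-sameRow lam α c₁ c₂ γ same rewrite isRook-sameRow α c₁ c₂ γ same = ≈-refl

  if-pow-shift : (b : Bool) (m m′ k : ℕ) → (b ≡ true → m ≡ m′ ℕ.+ k) →
    (if b then pow q m else 0#) ≈ pow q k * (if b then pow q m′ else 0#)
  if-pow-shift true  m m′ k shift rewrite shift refl = ≈-trans (pow-+ q m′ k) (*-comm _ _)
  if-pow-shift false m m′ k shift = ≈-sym (zeroʳ _)

  weight-addRook : {lam : SubsetN N} {y t : Fin N} (y∈S : inS μ y ≡ true) (t∈T : inT μ t ≡ true) (y<t : y < t)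
    (y∈λ : lam y ≡ true) (t∈λ : lam t ≡ true) (α : List (Cell N)) → All (BelowRow y) α →
    weight lam (α ++ (y , t) ∷ []) ≈ pow q (countAbove lam t) * weight (AddRook.lam′ y∈S t∈T y<t y∈λ t∈λ) α
  weight-addRook {lam} {y} {t} y∈S t∈T y<t y∈λ t∈λ α below =
    ≈-trans (≈-reflexive (cong (λ b → if b then pow q (inv (α ++ (y , t) ∷ [])) else 0#) (placement-addRook α below)))
            (if-pow-shift _ (inv (α ++ (y , t) ∷ [])) (inv α) (countAbove lam t) shift)
    where
    open AddRook y∈S t∈T y<t y∈λ t∈λ
    shift : isRook α ∧ sameSubset (typeOf α) lam′ ≡ true → inv (α ++ (y , t) ∷ []) ≡ inv α ℕ.+ countAbove lam t
    shift e = inv-addRook α below (proj₁ (∧-true⁻ e)) (sameSubset-true⁻ (typeOf α) lam′ (proj₂ (∧-true⁻ e)))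

  Increasing : List (Fin N) → Set
  Increasing = AllPairs.AllPairs _<_

  RowClaim : List (Fin N) → Set ℓ
  RowClaim ss = (lam : SubsetN N) → Increasing ss → (∀ x → (lam ∩ inS μ) x ≡ true → x ∈ ss) → Balanced lam →
    ∑ (weight lam) (sublists (rows ss)) ≈ ∏ (λ s → qInt q (rho s μ lam)) (lamS μ lam)

  rowClaim-[] : RowClaim []
  rowClaim-[] lam _ cover balanced = begin
      weight lam [] + 0#
    ≈⟨ +-identityʳ _ ⟩
      weight lam []
    ≡⟨ cong (λ b → if b then 1# else 0#) (sameSubset-true⁺ (typeOf []) lam (λ x → sym (lam-empty x))) ⟩
      1#
    ≡⟨ cong (∏ (λ s → qInt q (rho s μ lam))) (sym (trans (boolFilter-cong S-empty (allFin N)) (boolFilter-none (allFin N)))) ⟩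
      ∏ (λ s → qInt q (rho s μ lam)) (lamS μ lam)
    ∎
    where
    S-empty : (lam ∩ inS μ) ≗ (λ _ → false)
    S-empty x with (lam ∩ inS μ) x in x∈λS
    ... | false = refl
    ... | true with cover x x∈λS
    ... | ()
    T-empty : (lam ∩ inT μ) ≗ (λ _ → false)
    T-empty = count-zero (trans (sym balanced) (trans (count-cong S-empty (allFin N)) (cong length (boolFilter-none (allFin N)))))
    lam-empty : ∀ x → lam x ≡ false
    lam-empty x with μ x in μx
    ... | true  = ∧-false-trueʳ (T-empty x) μx
    ... | false = ∧-false-trueʳ (S-empty x) (cong not μx)

  module LastRow {xs : List (Fin N)} {y : Fin N} (ih : RowClaim xs) (lam : SubsetN N)
                 (increasing : Increasing xs) (xs<y : All (_< y) xs)
                 (cover : ∀ x → (lam ∩ inS μ) x ≡ true → x ∈ xs ∷ʳ y) (balanced : Balanced lam) where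

    earlier : List (List (Cell N))
    earlier = sublists (rows xs)

    earlier-below : All (All (BelowRow y)) earlier
    earlier-below = sublists-All (rows-below xs xs<y)

    qIntRho : Fin N → Carrier
    qIntRho s = qInt q (rho s μ lam)

    rowsSum : Carrier
    rowsSum = ∑ (λ α → weight lam α + ∑ (λ c → weight lam (α ++ c ∷ [])) (row y)) earlier

    lastRookWeight : Cell N → Carrier
    lastRookWeight c = if lam (proj₂ c) then pow q (countAbove lam (proj₂ c)) else 0#

    cover-≤ : ∀ x → (lam ∩ inS μ) x ≡ true → toℕ x ℕ.≤ toℕ y
    cover-≤ x x∈λS with ∈-∷ʳ⁻ xs (cover x x∈λS)
    ... | inj₁ x∈xs = ℕ.<⇒≤ (All.lookup xs<y x∈xs)
    ... | inj₂ refl = ℕ.≤-refl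

    rowsSum-y∉λ : (lam ∩ inS μ) y ≡ false → rowsSum ≈ ∏ qIntRho (lamS μ lam)
    rowsSum-y∉λ y∉λS = begin
        rowsSum
      ≈⟨ ∑-cong (λ α → ≈-trans (+-congˡ (∑-vanish (All.map (newRowVanishes α) (row-All y)))) (+-identityʳ _)) earlier ⟩
        ∑ (weight lam) earlier
      ≈⟨ ih lam increasing cover-xs balanced ⟩
        ∏ qIntRho (lamS μ lam)
      ∎
      where
      newRowVanishes : ∀ α {c} → proj₁ c ≡ y × inB μ c ≡ true → weight lam (α ++ c ∷ []) ≈ 0#
      newRowVanishes α {c} (refl , c∈B) = weight-wrongType lam (α ++ c ∷ []) y λ eq →
        true≢false (trans (sym (typeOf-snoc-first α c)) (trans eq (∧-false-trueʳ y∉λS (proj₁ (proj₁ (inB⁻ c∈B))))))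
      cover-xs : ∀ x → (lam ∩ inS μ) x ≡ true → x ∈ xs
      cover-xs x x∈λS with ∈-∷ʳ⁻ xs (cover x x∈λS)
      ... | inj₁ x∈xs = x∈xs
      ... | inj₂ refl with trans (sym x∈λS) y∉λS
      ... | ()

    module _ (y∈λS : (lam ∩ inS μ) y ≡ true) where

      y∈λ : lam y ≡ true
      y∈λ = proj₁ (∧-true⁻ y∈λS)

      y∈S : inS μ y ≡ true
      y∈S = proj₂ (∧-true⁻ y∈λS)

      otherFactors : Carrier
      otherFactors = ∏ qIntRho (boolFilter (remove lam y ∩ inS μ) (allFin N))

      other-earlier : ∀ x → (remove lam y ∩ inS μ) x ≡ true → x ∈ xs
      other-earlier x x∈ with x ≟ y
      ... | yes refl = ⊥-elim (true≢false (trans (sym x∈) (cong (_∧ inS μ x) (remove-self lam x))))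
      ... | no x≢y with ∈-∷ʳ⁻ xs (cover x (trans (cong (_∧ inS μ x) (sym (remove-other lam x≢y))) x∈))
      ...   | inj₁ x∈xs = x∈xs
      ...   | inj₂ x≡y  = ⊥-elim (x≢y x≡y)

      column : ∀ {c} → proj₁ c ≡ y × inB μ c ≡ true →
        ∑ (λ α → weight lam (α ++ c ∷ [])) earlier ≈ lastRookWeight c * otherFactors
      column {s , t} (refl , c∈B) with lam t in t∈λ
      ... | false = ≈-trans (∑-vanish (All.universal wrongType earlier)) (≈-sym (zeroˡ otherFactors))
        where
        wrongType : ∀ α → weight lam (α ++ (y , t) ∷ []) ≈ 0#
        wrongType α = weight-wrongType lam (α ++ (y , t) ∷ []) t λ eq →
          true≢false (trans (sym (typeOf-snoc-second α (y , t))) (trans eq t∈λ))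
      ... | true = begin
          ∑ (λ α → weight lam (α ++ (y , t) ∷ [])) earlier
        ≈⟨ ∑-congᴬ (All.map (weight-addRook y∈S t∈T y<t y∈λ t∈λ _) earlier-below) ⟩
          ∑ (λ α → pow q (countAbove lam t) * weight lam′ α) earlier
        ≈⟨ ∑-*ˡ (pow q (countAbove lam t)) (weight lam′) earlier ⟩
          pow q (countAbove lam t) * ∑ (weight lam′) earlier
        ≈⟨ *-congˡ (ih lam′ increasing cover′ (balanced′ balanced)) ⟩
          pow q (countAbove lam t) * ∏ (λ s → qInt q (rho s μ lam′)) (lamS μ lam′)
        ≈⟨ *-congˡ (≈-trans (≈-reflexive (cong (∏ (λ s → qInt q (rho s μ lam′))) lamS-lam′)) (∏-congᴬ sameRho)) ⟩
          pow q (countAbove lam t) * otherFactors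
        ∎
        where
        t∈T : inT μ t ≡ true
        t∈T = proj₂ (proj₁ (inB⁻ c∈B))
        y<t : y < t
        y<t = proj₂ (inB⁻ c∈B)
        open AddRook y∈S t∈T y<t y∈λ t∈λ
        cover′ : ∀ x → (lam′ ∩ inS μ) x ≡ true → x ∈ xs
        cover′ x x∈ = other-earlier x (trans (sym (remove-∩-disjoint (remove lam y) (inS μ) t∉S x)) x∈)
        sameRho : All (λ s → qInt q (rho s μ lam′) ≈ qIntRho s) (boolFilter (remove lam y ∩ inS μ) (allFin N))
        sameRho = All.map (λ (_ , s∈) → ≈-reflexive (cong (qInt q) (rho-lam′ balanced _ (All.lookup xs<y (other-earlier _ s∈)))))
                          (boolFilter-All (remove lam y ∩ inS μ) (All.universal (λ _ → tt) (allFin N)))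

      rowTotal : ∑ lastRookWeight (row y) ≈ qIntRho y
      rowTotal = begin
          ∑ lastRookWeight (row y)
        ≡⟨ cong (∑ lastRookWeight) (boolFilter-map (inB μ) (y ,_) (allFin N)) ⟩
          ∑ lastRookWeight (map (y ,_) (boolFilter (inB μ ∘ (y ,_)) (allFin N)))
        ≡⟨ ∑-map lastRookWeight (y ,_) (boolFilter (inB μ ∘ (y ,_)) (allFin N)) ⟩
          ∑ (lastRookWeight ∘ (y ,_)) (boolFilter (inB μ ∘ (y ,_)) (allFin N))
        ≡⟨ cong (∑ (lastRookWeight ∘ (y ,_))) (boolFilter-cong (λ t → cong (_∧ Above t) y∈S) (allFin N)) ⟩
          ∑ (lastRookWeight ∘ (y ,_)) (boolFilter Above (allFin N))
        ≈⟨ ∑-boolFilter-if lam Above (λ t → pow q (countAbove lam t)) (allFin N) ⟩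
          ∑ (λ t → pow q (countAbove lam t)) (boolFilter (lam ∩ Above) (allFin N))
        ≈⟨ ∑-congᴬ (All.map (λ (_ , t∈) → ≈-reflexive (cong (pow q) (count-cong (above-trans (above⇒y< t∈)) (allFin N))))
                           (boolFilter-All (lam ∩ Above) (All.universal (λ _ → tt) (allFin N)))) ⟩
          ∑ (λ t → pow q (count (λ z → (lam ∩ Above) z ∧ (t <F z)) (allFin N))) (boolFilter (lam ∩ Above) (allFin N))
        ≈⟨ ∑-pow-larger≈qInt q (lam ∩ Above) ⟩
          qInt q (countAbove lam y)
        ≡⟨ cong (qInt q) (sym (rho-top balanced y∈S cover-≤)) ⟩
          qIntRho y
        ∎
        where
        Above : SubsetN N
        Above t = inT μ t ∧ (y <F t)
        above⇒y< : ∀ {t} → (lam ∩ Above) t ≡ true → y < t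
        above⇒y< {t} t∈ = <F⇒< (proj₂ (∧-true⁻ {inT μ t} (proj₂ (∧-true⁻ {lam t} t∈))))
        above-trans : ∀ {t} → y < t → ∀ z → lam z ∧ (inT μ z ∧ (t <F z)) ≡ (lam ∩ Above) z ∧ (t <F z)
        above-trans {t} y<t z with t <F z in t<z
        ... | false = trans (cong (lam z ∧_) (∧-zeroʳ _)) (trans (∧-zeroʳ _) (sym (∧-zeroʳ _)))
        ... | true  = sym (trans (∧-identityʳ _) (cong (λ b → lam z ∧ (inT μ z ∧ b)) y<z))
          where
          y<z : (y <F z) ≡ true
          y<z = <⇒<F {x = y} {y = z} (ℕ.<-trans y<t (<F⇒< {x = t} {y = z} t<z))

      rowsSum-y∈λ : rowsSum ≈ ∏ qIntRho (lamS μ lam)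
      rowsSum-y∈λ = begin
          rowsSum
        ≈⟨ ∑-congᴬ (All.map (λ below → ≈-trans (+-congʳ (rowY-empty-vanishes below)) (+-identityˡ _)) earlier-below) ⟩
          ∑ (λ α → ∑ (λ c → weight lam (α ++ c ∷ [])) (row y)) earlier
        ≈⟨ ∑-swap (λ α c → weight lam (α ++ c ∷ [])) earlier (row y) ⟩
          ∑ (λ c → ∑ (λ α → weight lam (α ++ c ∷ [])) earlier) (row y)
        ≈⟨ ∑-congᴬ (All.map column (row-All y)) ⟩
          ∑ (λ c → lastRookWeight c * otherFactors) (row y)
        ≈⟨ ∑-*ʳ otherFactors lastRookWeight (row y) ⟩
          ∑ lastRookWeight (row y) * otherFactors
        ≈⟨ *-congʳ rowTotal ⟩
          qIntRho y * otherFactors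
        ≈⟨ ≈-sym (ΠFold.foldFilter-remove qIntRho lam (inS μ) y∈λ y∈S) ⟩
          ∏ qIntRho (lamS μ lam)
        ∎
        where
        rowY-empty-vanishes : ∀ {α} → All (BelowRow y) α → weight lam α ≈ 0#
        rowY-empty-vanishes {α} below =
          weight-wrongType lam α y λ eq → true≢false (trans (sym y∈λ) (trans (sym eq) (typeOf-below y∈S below)))

  rowClaim-∷ʳ : {xs : List (Fin N)} (y : Fin N) → RowClaim xs → RowClaim (xs ∷ʳ y)
  rowClaim-∷ʳ {xs} y ih lam increasing cover balanced = begin
      ∑ (weight lam) (sublists (rows (xs ∷ʳ y)))
    ≡⟨ cong (∑ (weight lam) ∘ sublists) (rows-∷ʳ xs y) ⟩
      ∑ (weight lam) (sublists (rows xs ++ row y))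
    ≈⟨ ∑-sublists-++ (weight lam) (rows xs) (row y) ⟩
      ∑ (λ α → ∑ (λ β → weight lam (α ++ β)) (sublists (row y))) earlier
    ≈⟨ ∑-cong atMostOneInRow earlier ⟩
      rowsSum
    ≈⟨ byLastRow ((lam ∩ inS μ) y) refl ⟩
      ∏ qIntRho (lamS μ lam)
    ∎
    where
    open LastRow ih lam (proj₁ (AllPairs-∷ʳ⁻ xs increasing)) (proj₂ (AllPairs-∷ʳ⁻ xs increasing)) cover balanced
    atMostOneInRow : ∀ α →
      ∑ (λ β → weight lam (α ++ β)) (sublists (row y)) ≈ weight lam α + ∑ (λ c → weight lam (α ++ c ∷ [])) (row y)
    atMostOneInRow α =
      ≈-trans (∑-sublists-atMostOne (λ β → weight lam (α ++ β)) (All.map proj₁ (row-All y))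
                                    (λ γ e₁ e₂ → weight-sameRow lam α _ _ γ (trans e₁ (sym e₂))))
              (+-congʳ (≈-reflexive (cong (weight lam) (++-identityʳ α))))
    byLastRow : ∀ b → (lam ∩ inS μ) y ≡ b → rowsSum ≈ ∏ qIntRho (lamS μ lam)
    byLastRow true  y∈λS = rowsSum-y∈λ y∈λS
    byLastRow false y∉λS = rowsSum-y∉λ y∉λS

  rowClaim : {ss : List (Fin N)} → Reverse ss → RowClaim ss
  rowClaim []              = rowClaim-[]
  rowClaim (xs ∶ rs ∶ʳ y) = rowClaim-∷ʳ y (rowClaim rs)

lemma3p10 : ∀ {c ℓ} (R : CommutativeRing c ℓ) (N : ℕ) (μ : Word N) (lam : SubsetN N) →
    Admissible μ lam →
    let open CommutativeRing R
        open RingOps R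
    in (q u : Carrier) → ¬ (q ≈ 0#) → ¬ (q ≈ 1#) → (q + - 1#) * u ≈ 1# →
       sumR (map (λ σ → pow q (inv σ)) (rookPlacements μ lam))
         ≈ prodR (map (λ s → (pow q (rho s μ lam) + - 1#) * u) (lamS μ lam))
lemma3p10 R N μ lam (balanced , _) q u _ _ inverse = begin
    ∑ (λ σ → pow q (inv σ)) (rookPlacements μ lam)
  ≈⟨ ∑-boolFilter (λ σ → pow q (inv σ)) _ (sublists (board μ)) ⟩
    ∑ (weight lam) (sublists (board μ))
  ≡⟨ cong (∑ (weight lam) ∘ sublists) board≡rows ⟩
    ∑ (weight lam) (sublists (rows (allFin N)))
  ≈⟨ rowClaim (reverseView (allFin N)) lam (tabulate⁺-< id) (λ x _ → ∈-allFin x) balanced ⟩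
    ∏ (λ s → qInt q (rho s μ lam)) (lamS μ lam)
  ≈⟨ ∏-congᴬ (All.universal (λ s → ≈-sym (qInt-as-quotient q inverse (rho s μ lam))) (lamS μ lam)) ⟩
    ∏ (λ s → (pow q (rho s μ lam) + - 1#) * u) (lamS μ lam)
  ∎
  where
  open CommutativeRing R using (_+_; _*_; -_; 1#; setoid) renaming (sym to ≈-sym)
  open RingOps R
  open RingSums R
  open Board μ
  open RookSums R μ q
  open import Relation.Binary.Reasoning.Setoid setoid
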